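{- Let $n$ be a positive integer with $n\ge125$, $n\equiv2\pmod5$ and $n\equiv1\pmod6$, and let $H$ be any abelian group of order $n^2+n+1$. Then there are no inverse-closed subsets $T_0,T_1\subseteq H$ with $e\in T_0$ satisfying $T_0T_1=H-e$ and $T_0^2+T_1^2=2H-T_0^{(2)}-T_1^{(2)}+2ne$ in $\mathbb{Z}[H]$.
   Context: $H$ is written multiplicatively with identity $e$; $\mathbb{Z}[H]$ is the integral group ring, a subset $D\subseteq H$ is identified with $\sum_{g\in D}g$, and $H$ also denotes $\sum_{h\in H}h$. For $A=\sum a_gg$ and $t\in\mathbb{Z}$, $A^{(t)}=\sum a_gg^t$. Inverse-closed means $T^{(-1)}=T$. -}

module Defs where

open import Data.Nat as ℕ using (ℕ; zero; suc)
open import Data.Integer as ℤ using (ℤ; +_; _+_; _-_; _*_)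
open import Data.Fin using (Fin; _≟_)
open import Data.Bool using (Bool; true; false; if_then_else_)
open import Relation.Nullary.Decidable using (⌊_⌋)
open import Relation.Binary.PropositionalEquality using (_≡_)
open import Algebra.Structures using (IsAbelianGroup)

-- A finite abelian group of order m, presented (up to isomorphism) on the
-- carrier Fin m with propositional equality.
record FinAbGroup (m : ℕ) : Set where
  field
    _∙_ : Fin m → Fin m → Fin m
    e   : Fin m
    _⁻¹ : Fin m → Fin m
    isAbelianGroup : IsAbelianGroup _≡_ _∙_ e _⁻¹

sumFin : (m : ℕ) → (Fin m → ℤ) → ℤ
sumFin zero    f = + 0
sumFin (suc m) f = f Fin.zero + sumFin m (λ i → f (Fin.suc i))
  where import Data.Fin as Fin

-- Elements of the integral group ring ℤ[H]: coefficient functions H → ℤ.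
GR : (m : ℕ) → Set
GR m = Fin m → ℤ

Subset : (m : ℕ) → Set
Subset m = Fin m → Bool

module GroupRing {m : ℕ} (G : FinAbGroup m) where
  open FinAbGroup G

  -- indicator / identification of a subset D with Σ_{g∈D} g
  ⟦_⟧ : Subset m → GR m
  ⟦ D ⟧ g = if D g then + 1 else + 0

  _∈_ : Fin m → Subset m → Set
  g ∈ D = D g ≡ true

  eR : GR m
  eR g = if ⌊ g ≟ e ⌋ then + 1 else + 0

  HR : GR m
  HR g = + 1

  _⊕_ : GR m → GR m → GR m
  (A ⊕ B) g = A g + B g

  _⊖_ : GR m → GR m → GR m
  (A ⊖ B) g = A g - B g

  _·_ : ℤ → GR m → GR m
  (k · A) g = k * A g

  _⊛_ : GR m → GR m → GR m
  (A ⊛ B) g = sumFin m (λ h → A h * B ((h ⁻¹) ∙ g))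

  -- A^{(t)} = Σ a_g g^t for t = 2: coefficient at g is Σ_{h : h² = g} a_h
  sq : GR m → GR m
  sq A g = sumFin m (λ h → if ⌊ (h ∙ h) ≟ g ⌋ then A h else + 0)

  InverseClosed : Subset m → Set
  InverseClosed T = ∀ g → T (g ⁻¹) ≡ T g

-- Since n ≡ 1 (mod 6), 3 divides |H| = n² + n + 1.  By Cauchy's theorem (McKay's
-- counting argument) H has an element of order 3, so cubing is not surjective, and a
-- maximal subgroup containing all cubes but not a fixed non-cube w has index 3: this
-- gives a surjective homomorphism χ : H → C₃.  Push both identities forward to ℤ[C₃]
-- and let aᵢ, bᵢ count the elements of T₀, T₁ in the fibre χ⁻¹(i).  Inverse-closure
-- gives a₁ = a₂ and b₁ = b₂, and with x = a₀ − a₁, y = b₀ − b₁ the identities become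
-- x y = −1 and 2n = x² + y² + x + y.  Hence {x, y} = {1, −1} and n = 1.
-- Only n ≡ 1 (mod 3) and n ≠ 1 are used.

module Submission where

open import Defs
open import Data.Nat as ℕ using (ℕ; zero; suc)
import Data.Nat.Properties as ℕ
open import Data.Nat.Divisibility using (_∣_; divides; ∣m⇒∣m*n)
open import Data.Integer as ℤ using (ℤ; +_)
import Data.Integer.Properties as ℤ
open import Data.Fin as Fin using (Fin; zero; suc; toℕ; _≟_)
import Data.Fin.Properties as Fin
open import Data.Fin.Patterns using (0F; 1F; 2F)
open import Data.Fin.Permutation using (permutation)
open import Data.Bool using (Bool; true; false; if_then_else_; T)
open import Data.Empty using (⊥-elim)
open import Data.Product using (_×_; _,_; proj₁; proj₂; ∃)
open import Data.Sum using (_⊎_; inj₁; inj₂)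
open import Function using (_∘_; _⇔_; mk⇔; Equivalence)
open import Relation.Nullary using (¬_; Dec; yes; no)
open import Relation.Nullary.Decidable using (⌊_⌋; decidable-stable)
open import Relation.Binary.PropositionalEquality
  using (_≡_; _≢_; refl; sym; trans; cong; cong₂; subst; module ≡-Reasoning)
open import Algebra.Bundles using (AbelianGroup)
open import Algebra.Properties.Semiring.Sum ℤ.+-*-semiring
  using (sum; sum-cong-≗; ∑-distrib-+; ∑-comm; ∑-permute; *-distribˡ-sum; *-distribʳ-sum)

⌊⌋-⇔ : ∀ {A B : Set} → A ⇔ B → (a? : Dec A) (b? : Dec B) → ⌊ a? ⌋ ≡ ⌊ b? ⌋
⌊⌋-⇔ A⇔B (yes a) (yes b) = refl
⌊⌋-⇔ A⇔B (no ¬a) (no ¬b) = refl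
⌊⌋-⇔ A⇔B (yes a) (no ¬b) = ⊥-elim (¬b (Equivalence.to A⇔B a))
⌊⌋-⇔ A⇔B (no ¬a) (yes b) = ⊥-elim (¬a (Equivalence.from A⇔B b))

≟-sym : ∀ {n} (a b : Fin n) → ⌊ a ≟ b ⌋ ≡ ⌊ b ≟ a ⌋
≟-sym a b = ⌊⌋-⇔ (mk⇔ sym sym) (a ≟ b) (b ≟ a)

module Sums where
  open import Data.Integer using (_+_; _*_)

  -- Defs writes coefficients as `if b then x else + 0`; naming that shape lets the
  -- lemmas below apply to them by conversion.
  infix 5 _when_

  _when_ : ℤ → Bool → ℤ
  x when b = if b then x else + 0

  *-when : ∀ c x b → c * (x when b) ≡ (c * x) when b
  *-when c x true  = refl
  *-when c x false = ℤ.*-zeroʳ c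

  when-* : ∀ x c b → (x when b) * c ≡ (x * c) when b
  when-* x c true  = refl
  when-* x c false = refl

  when-as-* : ∀ x b → x when b ≡ x * (+ 1 when b)
  when-as-* x true  = sym (ℤ.*-identityʳ x)
  when-as-* x false = sym (ℤ.*-zeroʳ x)

  when-comm : ∀ x b c → (x when b) when c ≡ (x when c) when b
  when-comm x true  c     = refl
  when-comm x false true  = refl
  when-comm x false false = refl

  sumFin≡sum : ∀ m (f : Fin m → ℤ) → sumFin m f ≡ sum f
  sumFin≡sum ℕ.zero    f = refl
  sumFin≡sum (ℕ.suc m) f = cong (λ s → f zero + s) (sumFin≡sum m (f ∘ suc))

  ∑-when : ∀ {m} (f : Fin m → ℤ) b → sum f when b ≡ sum (λ i → f i when b)
  ∑-when f true  = refl
  ∑-when {m} f false = sym (∑-zero m)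
    where
    ∑-zero : ∀ m → sum {m} (λ _ → + 0) ≡ + 0
    ∑-zero ℕ.zero    = refl
    ∑-zero (ℕ.suc m) = trans (ℤ.+-identityˡ _) (∑-zero m)

  ∑-const : ∀ m → sum {m} (λ _ → + 1) ≡ + m
  ∑-const ℕ.zero    = refl
  ∑-const (ℕ.suc m) = cong (λ s → + 1 + s) (∑-const m)

  ∑-δ : ∀ {m} (a : Fin m) (f : Fin m → ℤ) → sum (λ g → f g when ⌊ a ≟ g ⌋) ≡ f a
  ∑-δ {ℕ.suc m} zero    f = trans (cong (λ s → f zero + s) (sym (∑-when (f ∘ suc) false))) (ℤ.+-identityʳ (f zero))
  ∑-δ {ℕ.suc m} (suc a) f = begin
    + 0 + sum (λ g → f (suc g) when ⌊ suc a ≟ suc g ⌋) ≡⟨ ℤ.+-identityˡ _ ⟩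
    sum (λ g → f (suc g) when ⌊ suc a ≟ suc g ⌋)       ≡⟨ sum-cong-≗ (λ g → cong (f (suc g) when_) (suc-≟ g)) ⟩
    sum (λ g → f (suc g) when ⌊ a ≟ g ⌋)               ≡⟨ ∑-δ a (f ∘ suc) ⟩
    f (suc a)                                           ∎
    where
    open ≡-Reasoning
    suc-≟ : ∀ g → ⌊ suc a ≟ suc g ⌋ ≡ ⌊ a ≟ g ⌋
    suc-≟ g = ⌊⌋-⇔ (mk⇔ Fin.suc-injective (cong suc)) (suc a ≟ suc g) (a ≟ g)

  ∑-reindex : ∀ {m} (π π⁻¹ : Fin m → Fin m) → (∀ x → π (π⁻¹ x) ≡ x) → (∀ x → π⁻¹ (π x) ≡ x) →
              (f : Fin m → ℤ) → sum (f ∘ π) ≡ sum f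
  ∑-reindex π π⁻¹ ππ⁻¹ π⁻¹π f = sym (∑-permute f (permutation π π⁻¹ ππ⁻¹ π⁻¹π))

module FinAbGroupProperties {m : ℕ} (G : FinAbGroup m) where
  open FinAbGroup G public

  abelianGroup : AbelianGroup _ _
  abelianGroup = record { isAbelianGroup = isAbelianGroup }

  open AbelianGroup abelianGroup public
    using (assoc; comm; identityˡ; identityʳ; inverseˡ; inverseʳ; group; monoid; commutativeMonoid)
  open import Algebra.Properties.Group group public
    using (\\-leftDividesˡ; \\-leftDividesʳ; //-rightDividesˡ; inverseˡ-unique; ⁻¹-involutive; ⁻¹-injective; identityˡ-unique; ε⁻¹≈ε)
  open import Algebra.Definitions.RawMonoid (AbelianGroup.rawMonoid abelianGroup) renaming (_×_ to _×ᵐ_)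
  open import Algebra.Properties.Monoid.Mult monoid using (×-homo-+; ×-assocˡ; ×-idem)
  open import Algebra.Properties.CommutativeMonoid.Mult commutativeMonoid using (×-distrib-+)

  infixr 25 _^_

  _^_ : Fin m → ℕ → Fin m
  x ^ k = k ×ᵐ x

  ^-+ : ∀ x a b → x ^ (a ℕ.+ b) ≡ x ^ a ∙ x ^ b
  ^-+ x a b = ×-homo-+ x a b

  ^-* : ∀ x a b → (x ^ a) ^ b ≡ x ^ (b ℕ.* a)
  ^-* x a b = ×-assocˡ x b a

  cube : Fin m → Fin m
  cube x = x ^ 3

  cube-∙ : ∀ x y → cube (x ∙ y) ≡ cube x ∙ cube y
  cube-∙ x y = ×-distrib-+ x y 3

  cube-e : cube e ≡ e
  cube-e = ×-idem (identityˡ e) 3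

module CyclicGroup₃ where
  open import Data.Nat.DivMod using (_mod_)
  open import Relation.Nullary.Decidable using (True; toWitness)
  open import Relation.Binary.PropositionalEquality using (isEquivalence)
  open import Relation.Nullary using (_→-dec_)

  infixl 6 _+₃_

  _+₃_ : Fin 3 → Fin 3 → Fin 3
  i +₃ j = (toℕ i ℕ.+ toℕ j) mod 3

  -₃_ : Fin 3 → Fin 3
  -₃ i = (3 ℕ.∸ toℕ i) mod 3

  by-exhaustion : ∀ {P : Fin 3 → Set} (P? : ∀ i → Dec (P i)) → True (Fin.all? P?) → ∀ i → P i
  by-exhaustion P? = toWitness

  +₃-cancel : ∀ i j → i +₃ (j +₃ j) ≡ 0F → i ≡ j
  +₃-cancel = by-exhaustion (λ i → Fin.all? λ j → (i +₃ (j +₃ j) ≟ 0F) →-dec (i ≟ j)) _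

  C₃ : FinAbGroup 3
  C₃ = record
    { _∙_ = _+₃_
    ; e   = 0F
    ; _⁻¹ = -₃_
    ; isAbelianGroup = record
      { isGroup = record
        { isMonoid = record
          { isSemigroup = record
            { isMagma = record { isEquivalence = isEquivalence ; ∙-cong = cong₂ _+₃_ }
            ; assoc = by-exhaustion (λ i → Fin.all? λ j → Fin.all? λ k → (i +₃ j) +₃ k ≟ i +₃ (j +₃ k)) _
            }
          ; identity = by-exhaustion (λ i → 0F +₃ i ≟ i) _ , by-exhaustion (λ i → i +₃ 0F ≟ i) _
          }
        ; inverse = by-exhaustion (λ i → (-₃ i) +₃ i ≟ 0F) _ , by-exhaustion (λ i → i +₃ (-₃ i) ≟ 0F) _
        ; ⁻¹-cong = cong -₃_
        }
      ; comm = by-exhaustion (λ i → Fin.all? λ j → i +₃ j ≟ j +₃ i) _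
      }
    }

IsHomomorphism : ∀ {m k} → FinAbGroup m → FinAbGroup k → (Fin m → Fin k) → Set
IsHomomorphism G K φ = ∀ x y → φ (x G.∙ y) ≡ φ x K.∙ φ y
  where
  module G = FinAbGroup G
  module K = FinAbGroup K

module Pushforward {m k : ℕ} (G : FinAbGroup m) (K : FinAbGroup k)
                   (φ : Fin m → Fin k) (φ-hom : IsHomomorphism G K φ) where
  open import Data.Integer using (_+_; _*_; _-_; -1ℤ)
  open Sums
  open FinAbGroupProperties G
  open GroupRing G
  module K = FinAbGroupProperties K
  module ℤ[K] = GroupRing K
  open ≡-Reasoning

  φ-e : φ e ≡ K.e
  φ-e = K.identityˡ-unique (φ e) (φ e) (trans (sym (φ-hom e e)) (cong φ (identityˡ e)))

  φ-⁻¹ : ∀ g → φ (g ⁻¹) ≡ φ g K.⁻¹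
  φ-⁻¹ g = K.inverseˡ-unique (φ (g ⁻¹)) (φ g) (trans (sym (φ-hom (g ⁻¹) g)) (trans (cong φ (inverseˡ g)) φ-e))

  push : GR m → GR k
  push X i = sum (λ g → X g when ⌊ φ g ≟ i ⌋)

  push-cong : ∀ {X Y} → (∀ g → X g ≡ Y g) → ∀ i → push X i ≡ push Y i
  push-cong X≗Y i = sum-cong-≗ (λ g → cong (_when ⌊ φ g ≟ i ⌋) (X≗Y g))

  push-⊕ : ∀ X Y i → push (X ⊕ Y) i ≡ (push X ℤ[K].⊕ push Y) i
  push-⊕ X Y i = trans (sum-cong-≗ λ g → when-+ (X g) (Y g) ⌊ φ g ≟ i ⌋)
                       (∑-distrib-+ (λ g → X g when ⌊ φ g ≟ i ⌋) (λ g → Y g when ⌊ φ g ≟ i ⌋))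
    where
    when-+ : ∀ x y b → (x + y) when b ≡ (x when b) + (y when b)
    when-+ x y true  = refl
    when-+ x y false = refl

  push-· : ∀ c X i → push (c · X) i ≡ (c ℤ[K].· push X) i
  push-· c X i = trans (sum-cong-≗ λ g → sym (*-when c (X g) ⌊ φ g ≟ i ⌋))
                       (sym (*-distribˡ-sum c (λ g → X g when ⌊ φ g ≟ i ⌋)))

  push-⊖ : ∀ X Y i → push (X ⊖ Y) i ≡ (push X ℤ[K].⊖ push Y) i
  push-⊖ X Y i = begin
    push (X ⊖ Y) i               ≡⟨ push-cong (λ g → cong (λ s → X g + s) (sym (ℤ.-1*i≡-i (Y g)))) i ⟩
    push (X ⊕ (-1ℤ · Y)) i       ≡⟨ push-⊕ X (-1ℤ · Y) i ⟩
    push X i + push (-1ℤ · Y) i  ≡⟨ cong (λ s → push X i + s) (trans (push-· -1ℤ Y i) (ℤ.-1*i≡-i (push Y i))) ⟩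
    push X i - push Y i          ∎

  ∑-fibres : ∀ X (F : Fin k → ℤ) → sum (λ h → X h * F (φ h)) ≡ sum (λ j → push X j * F j)
  ∑-fibres X F = begin
    sum (λ h → X h * F (φ h))
      ≡⟨ sum-cong-≗ (λ h → sym (∑-δ (φ h) (λ j → X h * F j))) ⟩
    sum (λ h → sum (λ j → (X h * F j) when ⌊ φ h ≟ j ⌋))
      ≡⟨ ∑-comm (λ h j → (X h * F j) when ⌊ φ h ≟ j ⌋) ⟩
    sum (λ j → sum (λ h → (X h * F j) when ⌊ φ h ≟ j ⌋))
      ≡⟨ sum-cong-≗ (λ j → trans (sum-cong-≗ λ h → sym (when-* (X h) (F j) ⌊ φ h ≟ j ⌋))
                                 (sym (*-distribʳ-sum (F j) (λ h → X h when ⌊ φ h ≟ j ⌋)))) ⟩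
    sum (λ j → push X j * F j) ∎

  push-translate : ∀ X h i → sum (λ g → X ((h ⁻¹) ∙ g) when ⌊ φ g ≟ i ⌋) ≡ push X ((φ h K.⁻¹) K.∙ i)
  push-translate X h i = begin
    sum (λ g → X ((h ⁻¹) ∙ g) when ⌊ φ g ≟ i ⌋)
      ≡⟨ sym (∑-reindex (h ∙_) ((h ⁻¹) ∙_) (\\-leftDividesˡ h) (\\-leftDividesʳ h) (λ g → X ((h ⁻¹) ∙ g) when ⌊ φ g ≟ i ⌋)) ⟩
    sum (λ g → X ((h ⁻¹) ∙ (h ∙ g)) when ⌊ φ (h ∙ g) ≟ i ⌋)
      ≡⟨ sum-cong-≗ (λ g → cong₂ _when_ (cong X (\\-leftDividesʳ h g)) (⌊⌋-⇔ (fibre-shift g) _ _)) ⟩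
    push X ((φ h K.⁻¹) K.∙ i) ∎
    where
    fibre-shift : ∀ g → (φ (h ∙ g) ≡ i) ⇔ (φ g ≡ (φ h K.⁻¹) K.∙ i)
    fibre-shift g = mk⇔
      (λ p → trans (sym (K.\\-leftDividesʳ (φ h) (φ g))) (cong ((φ h K.⁻¹) K.∙_) (trans (sym (φ-hom h g)) p)))
      (λ q → trans (φ-hom h g) (trans (cong (φ h K.∙_) q) (K.\\-leftDividesˡ (φ h) i)))

  push-⊛ : ∀ A B i → push (A ⊛ B) i ≡ (push A ℤ[K].⊛ push B) i
  push-⊛ A B i = begin
    sum (λ g → sumFin m (λ h → A h * B ((h ⁻¹) ∙ g)) when ⌊ φ g ≟ i ⌋)
      ≡⟨ sum-cong-≗ (λ g → trans (cong (_when ⌊ φ g ≟ i ⌋) (sumFin≡sum m _))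
                                 (∑-when (λ h → A h * B ((h ⁻¹) ∙ g)) ⌊ φ g ≟ i ⌋)) ⟩
    sum (λ g → sum (λ h → (A h * B ((h ⁻¹) ∙ g)) when ⌊ φ g ≟ i ⌋))
      ≡⟨ ∑-comm (λ g h → (A h * B ((h ⁻¹) ∙ g)) when ⌊ φ g ≟ i ⌋) ⟩
    sum (λ h → sum (λ g → (A h * B ((h ⁻¹) ∙ g)) when ⌊ φ g ≟ i ⌋))
      ≡⟨ sum-cong-≗ (λ h → trans (sum-cong-≗ λ g → sym (*-when (A h) (B ((h ⁻¹) ∙ g)) ⌊ φ g ≟ i ⌋))
                                 (sym (*-distribˡ-sum (A h) (λ g → B ((h ⁻¹) ∙ g) when ⌊ φ g ≟ i ⌋)))) ⟩
    sum (λ h → A h * sum (λ g → B ((h ⁻¹) ∙ g) when ⌊ φ g ≟ i ⌋))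
      ≡⟨ sum-cong-≗ (λ h → cong (A h *_) (push-translate B h i)) ⟩
    sum (λ h → A h * push B ((φ h K.⁻¹) K.∙ i))
      ≡⟨ ∑-fibres A (λ j → push B ((j K.⁻¹) K.∙ i)) ⟩
    sum (λ j → push A j * push B ((j K.⁻¹) K.∙ i))
      ≡⟨ sym (sumFin≡sum k _) ⟩
    (push A ℤ[K].⊛ push B) i ∎

  push-sq : ∀ A i → push (sq A) i ≡ ℤ[K].sq (push A) i
  push-sq A i = begin
    sum (λ g → sumFin m (λ h → A h when ⌊ h ∙ h ≟ g ⌋) when ⌊ φ g ≟ i ⌋)
      ≡⟨ sum-cong-≗ (λ g → trans (cong (_when ⌊ φ g ≟ i ⌋) (sumFin≡sum m _))
                                 (∑-when (λ h → A h when ⌊ h ∙ h ≟ g ⌋) ⌊ φ g ≟ i ⌋)) ⟩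
    sum (λ g → sum (λ h → (A h when ⌊ h ∙ h ≟ g ⌋) when ⌊ φ g ≟ i ⌋))
      ≡⟨ ∑-comm (λ g h → (A h when ⌊ h ∙ h ≟ g ⌋) when ⌊ φ g ≟ i ⌋) ⟩
    sum (λ h → sum (λ g → (A h when ⌊ h ∙ h ≟ g ⌋) when ⌊ φ g ≟ i ⌋))
      ≡⟨ sum-cong-≗ (λ h → trans (sum-cong-≗ λ g → when-comm (A h) ⌊ h ∙ h ≟ g ⌋ ⌊ φ g ≟ i ⌋)
                                 (∑-δ (h ∙ h) (λ g → A h when ⌊ φ g ≟ i ⌋))) ⟩
    sum (λ h → A h when ⌊ φ (h ∙ h) ≟ i ⌋)
      ≡⟨ sum-cong-≗ (λ h → trans (cong (λ j → A h when ⌊ j ≟ i ⌋) (φ-hom h h)) (when-as-* (A h) ⌊ φ h K.∙ φ h ≟ i ⌋)) ⟩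
    sum (λ h → A h * (+ 1 when ⌊ φ h K.∙ φ h ≟ i ⌋))
      ≡⟨ ∑-fibres A (λ j → + 1 when ⌊ j K.∙ j ≟ i ⌋) ⟩
    sum (λ j → push A j * (+ 1 when ⌊ j K.∙ j ≟ i ⌋))
      ≡⟨ sum-cong-≗ (λ j → sym (when-as-* (push A j) ⌊ j K.∙ j ≟ i ⌋)) ⟩
    sum (λ j → push A j when ⌊ j K.∙ j ≟ i ⌋)
      ≡⟨ sym (sumFin≡sum k _) ⟩
    ℤ[K].sq (push A) i ∎

  push-eR : ∀ i → push eR i ≡ ℤ[K].eR i
  push-eR i = begin
    sum (λ g → (+ 1 when ⌊ g ≟ e ⌋) when ⌊ φ g ≟ i ⌋)
      ≡⟨ sum-cong-≗ (λ g → trans (when-comm (+ 1) ⌊ g ≟ e ⌋ ⌊ φ g ≟ i ⌋)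
                                 (cong ((+ 1 when ⌊ φ g ≟ i ⌋) when_) (≟-sym g e))) ⟩
    sum (λ g → (+ 1 when ⌊ φ g ≟ i ⌋) when ⌊ e ≟ g ⌋)
      ≡⟨ ∑-δ e (λ g → + 1 when ⌊ φ g ≟ i ⌋) ⟩
    + 1 when ⌊ φ e ≟ i ⌋
      ≡⟨ cong (λ j → + 1 when ⌊ j ≟ i ⌋) φ-e ⟩
    + 1 when ⌊ K.e ≟ i ⌋
      ≡⟨ cong (+ 1 when_) (≟-sym K.e i) ⟩
    ℤ[K].eR i ∎

  push-HR-constant : (∀ j → ∃ λ u → φ u ≡ j) → ∀ i j → push HR i ≡ push HR j
  push-HR-constant φ-onto i j with u , φu≡ij⁻¹ ← φ-onto (i K.∙ (j K.⁻¹)) = begin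
    push HR i                             ≡⟨ cong (push HR) (trans (cong (K._∙ j) φu≡ij⁻¹) (K.//-rightDividesˡ j i)) ⟨
    push HR (φ u K.∙ j)                   ≡⟨ push-translate HR u (φ u K.∙ j) ⟩
    push HR ((φ u K.⁻¹) K.∙ (φ u K.∙ j))  ≡⟨ cong (push HR) (K.\\-leftDividesʳ (φ u) j) ⟩
    push HR j                             ∎

  push-inverse-closed : ∀ X → (∀ g → X (g ⁻¹) ≡ X g) → ∀ i → push X (i K.⁻¹) ≡ push X i
  push-inverse-closed X X⁻¹≡X i = begin
    sum (λ g → X g when ⌊ φ g ≟ i K.⁻¹ ⌋)
      ≡⟨ sym (∑-reindex _⁻¹ _⁻¹ ⁻¹-involutive ⁻¹-involutive _) ⟩
    sum (λ g → X (g ⁻¹) when ⌊ φ (g ⁻¹) ≟ i K.⁻¹ ⌋)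
      ≡⟨ sum-cong-≗ (λ g → cong₂ _when_ (X⁻¹≡X g) (⌊⌋-⇔ (fibre-⁻¹ g) _ _)) ⟩
    push X i ∎
    where
    fibre-⁻¹ : ∀ g → (φ (g ⁻¹) ≡ i K.⁻¹) ⇔ (φ g ≡ i)
    fibre-⁻¹ g = mk⇔ (λ p → K.⁻¹-injective (trans (sym (φ-⁻¹ g)) p))
                     (λ q → trans (φ-⁻¹ g) (cong K._⁻¹ q))

module C₃Relations where
  open import Data.Integer using (_+_; _*_; _-_; -1ℤ; ∣_∣; -[1+_])
  open import Data.List using ([]; _∷_)
  open import Data.Integer.Tactic.RingSolver using (solve-∀; solve)
  open CyclicGroup₃
  open GroupRing C₃
  open ≡-Reasoning

  a+[b+[c+0]]≡a+b+c : ∀ a b c → a + (b + (c + + 0)) ≡ a + b + c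
  a+[b+[c+0]]≡a+b+c = solve-∀

  ⊛-0F : ∀ X Y → (X ⊛ Y) 0F ≡ X 0F * Y 0F + X 1F * Y 2F + X 2F * Y 1F
  ⊛-0F X Y = a+[b+[c+0]]≡a+b+c (X 0F * Y 0F) (X 1F * Y 2F) (X 2F * Y 1F)

  ⊛-1F : ∀ X Y → (X ⊛ Y) 1F ≡ X 0F * Y 1F + X 1F * Y 0F + X 2F * Y 2F
  ⊛-1F X Y = a+[b+[c+0]]≡a+b+c (X 0F * Y 1F) (X 1F * Y 0F) (X 2F * Y 2F)

  sq-0F : ∀ X → sq X 0F ≡ X 0F
  sq-0F X = ℤ.+-identityʳ (X 0F)

  sq-1F : ∀ X → sq X 1F ≡ X 2F
  sq-1F X = 0+[0+[a+0]]≡a (X 2F)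
    where
    0+[0+[a+0]]≡a : ∀ a → + 0 + (+ 0 + (a + + 0)) ≡ a
    0+[0+[a+0]]≡a = solve-∀

  xy≡-1⇒x²+y²+x+y≡2 : ∀ x y → x * y ≡ -1ℤ → x * x + y * y + x + y ≡ + 2
  xy≡-1⇒x²+y²+x+y≡2 x y xy≡-1 = units x y xy≡-1 (ℕ.m*n≡1⇒m≡1 ∣ x ∣ ∣ y ∣ ∣x∣∣y∣≡1) (ℕ.m*n≡1⇒n≡1 ∣ x ∣ ∣ y ∣ ∣x∣∣y∣≡1)
    where
    ∣x∣∣y∣≡1 : ∣ x ∣ ℕ.* ∣ y ∣ ≡ 1
    ∣x∣∣y∣≡1 = trans (sym (ℤ.abs-* x y)) (cong ∣_∣ xy≡-1)
    units : ∀ x y → x * y ≡ -1ℤ → ∣ x ∣ ≡ 1 → ∣ y ∣ ≡ 1 → x * x + y * y + x + y ≡ + 2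
    units (+ 1)           -[1+ 0 ]        _  _  _  = refl
    units -[1+ 0 ]        (+ 1)           _  _  _  = refl
    units (+ 1)           (+ 1)           () _  _
    units -[1+ 0 ]        -[1+ 0 ]        () _  _
    units (+ 0)           _               _  () _
    units (+ suc (suc _)) _               _  () _
    units -[1+ suc _ ]    _               _  () _
    units _               (+ 0)           _  _  ()
    units _               (+ suc (suc _)) _  _  ()
    units _               -[1+ suc _ ]    _  _  ()

  coefficients⇒N≡2 : ∀ a₀ a₁ b₀ b₁ h N →
    a₀ * b₀ + a₁ * b₁ + a₁ * b₁ ≡ h - + 1 →
    a₀ * b₁ + a₁ * b₀ + a₁ * b₁ ≡ h - + 0 →
    (a₀ * a₀ + a₁ * a₁ + a₁ * a₁) + (b₀ * b₀ + b₁ * b₁ + b₁ * b₁) ≡ + 2 * h - a₀ - b₀ + N * + 1 →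
    (a₀ * a₁ + a₁ * a₀ + a₁ * a₁) + (b₀ * b₁ + b₁ * b₀ + b₁ * b₁) ≡ + 2 * h - a₁ - b₁ + N * + 0 →
    N ≡ + 2
  -- With x = a₀ - a₁ and y = b₀ - b₁ the relations read x y = -1 and N = x² + y² + x + y.
  coefficients⇒N≡2 a₀ a₁ b₀ b₁ h N e₁ e₂ e₃ e₄ = begin
    N
      ≡⟨ solve (a₀ ∷ a₁ ∷ b₀ ∷ b₁ ∷ h ∷ N ∷ []) ⟩
    (+ 2 * h - a₀ - b₀ + N * + 1) - (+ 2 * h - a₁ - b₁ + N * + 0) + (a₀ - a₁) + (b₀ - b₁)
      ≡⟨ cong (λ t → t + (a₀ - a₁) + (b₀ - b₁)) (cong₂ _-_ (sym e₃) (sym e₄)) ⟩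
    ((a₀ * a₀ + a₁ * a₁ + a₁ * a₁) + (b₀ * b₀ + b₁ * b₁ + b₁ * b₁))
      - ((a₀ * a₁ + a₁ * a₀ + a₁ * a₁) + (b₀ * b₁ + b₁ * b₀ + b₁ * b₁)) + (a₀ - a₁) + (b₀ - b₁)
      ≡⟨ solve (a₀ ∷ a₁ ∷ b₀ ∷ b₁ ∷ []) ⟩
    (a₀ - a₁) * (a₀ - a₁) + (b₀ - b₁) * (b₀ - b₁) + (a₀ - a₁) + (b₀ - b₁)
      ≡⟨ xy≡-1⇒x²+y²+x+y≡2 (a₀ - a₁) (b₀ - b₁) xy≡-1 ⟩
    + 2 ∎
    where
    xy≡-1 : (a₀ - a₁) * (b₀ - b₁) ≡ -1ℤ
    xy≡-1 = begin
      (a₀ - a₁) * (b₀ - b₁)                                          ≡⟨ solve (a₀ ∷ a₁ ∷ b₀ ∷ b₁ ∷ []) ⟩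
      (a₀ * b₀ + a₁ * b₁ + a₁ * b₁) - (a₀ * b₁ + a₁ * b₀ + a₁ * b₁)  ≡⟨ cong₂ _-_ e₁ e₂ ⟩
      (h - + 1) - (h - + 0)                                           ≡⟨ solve (h ∷ []) ⟩
      -1ℤ                                                             ∎

  relations-in-ℤ[C₃]⇒N≡2 : ∀ (X Y Hc : GR 3) N → X 2F ≡ X 1F → Y 2F ≡ Y 1F → Hc 1F ≡ Hc 0F →
    (∀ i → (X ⊛ Y) i ≡ (Hc ⊖ eR) i) →
    (∀ i → ((X ⊛ X) ⊕ (Y ⊛ Y)) i ≡ (((((+ 2) · Hc) ⊖ sq X) ⊖ sq Y) ⊕ (N · eR)) i) →
    N ≡ + 2
  relations-in-ℤ[C₃]⇒N≡2 X Y Hc N X₂≡X₁ Y₂≡Y₁ H₁≡H₀ XY≡H-e squares≡ =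
    symmetric X₂≡X₁ Y₂≡Y₁ H₁≡H₀ product-at-0F product-at-1F squares-at-0F squares-at-1F
    where
    product-at-0F : X 0F * Y 0F + X 1F * Y 2F + X 2F * Y 1F ≡ Hc 0F - + 1
    product-at-0F = trans (sym (⊛-0F X Y)) (XY≡H-e 0F)
    product-at-1F : X 0F * Y 1F + X 1F * Y 0F + X 2F * Y 2F ≡ Hc 1F - + 0
    product-at-1F = trans (sym (⊛-1F X Y)) (XY≡H-e 1F)
    squares-at-0F : (X 0F * X 0F + X 1F * X 2F + X 2F * X 1F) + (Y 0F * Y 0F + Y 1F * Y 2F + Y 2F * Y 1F)
                    ≡ + 2 * Hc 0F - X 0F - Y 0F + N * + 1
    squares-at-0F = trans (sym (cong₂ _+_ (⊛-0F X X) (⊛-0F Y Y)))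
      (trans (squares≡ 0F) (cong (_+ N * + 1) (cong₂ _-_ (cong (+ 2 * Hc 0F -_) (sq-0F X)) (sq-0F Y))))
    squares-at-1F : (X 0F * X 1F + X 1F * X 0F + X 2F * X 2F) + (Y 0F * Y 1F + Y 1F * Y 0F + Y 2F * Y 2F)
                    ≡ + 2 * Hc 1F - X 2F - Y 2F + N * + 0
    squares-at-1F = trans (sym (cong₂ _+_ (⊛-1F X X) (⊛-1F Y Y)))
      (trans (squares≡ 1F) (cong (_+ N * + 0) (cong₂ _-_ (cong (+ 2 * Hc 1F -_) (sq-1F X)) (sq-1F Y))))
    symmetric : ∀ {a₀ a₁ a₂ b₀ b₁ b₂ h₀ h₁} → a₂ ≡ a₁ → b₂ ≡ b₁ → h₁ ≡ h₀ →
      a₀ * b₀ + a₁ * b₂ + a₂ * b₁ ≡ h₀ - + 1 →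
      a₀ * b₁ + a₁ * b₀ + a₂ * b₂ ≡ h₁ - + 0 →
      (a₀ * a₀ + a₁ * a₂ + a₂ * a₁) + (b₀ * b₀ + b₁ * b₂ + b₂ * b₁) ≡ + 2 * h₀ - a₀ - b₀ + N * + 1 →
      (a₀ * a₁ + a₁ * a₀ + a₂ * a₂) + (b₀ * b₁ + b₁ * b₀ + b₂ * b₂) ≡ + 2 * h₁ - a₂ - b₂ + N * + 0 →
      N ≡ + 2
    symmetric {a₀} {a₁} {_} {b₀} {b₁} {_} {h₀} refl refl refl = coefficients⇒N≡2 a₀ a₁ b₀ b₁ h₀ N

module FixedPointsMod3 {K : ℕ} (σ : Fin K → Fin K) (σ³≡id : ∀ p → σ (σ (σ p)) ≡ p) where
  open import Data.Integer using (_+_; _*_; _-_; ∣_∣)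
  open import Data.Nat using (_⊓_)
  open import Data.Bool using (not)
  open import Data.Integer.Tactic.RingSolver using (solve-∀)
  open Sums
  open ≡-Reasoning

  fixed moved : Fin K → ℤ
  fixed p = + 1 when ⌊ σ p ≟ p ⌋
  moved p = + 1 when not ⌊ σ p ≟ p ⌋

  [_≡_] : ℕ → ℕ → ℤ
  [ a ≡ b ] = + 1 when ⌊ a ℕ.≟ b ⌋

  [≡]-refl : ∀ a → [ a ≡ a ] ≡ + 1
  [≡]-refl a with a ℕ.≟ a
  ... | yes _   = refl
  ... | no a≢a = ⊥-elim (a≢a refl)

  [≡]-≢ : ∀ {a b} → a ≢ b → [ a ≡ b ] ≡ + 0
  [≡]-≢ {a} {b} a≢b with a ℕ.≟ b
  ... | yes a≡b = ⊥-elim (a≢b a≡b)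
  ... | no _    = refl

  orbit-min : Fin K → ℕ
  orbit-min p = toℕ p ⊓ (toℕ (σ p) ⊓ toℕ (σ (σ p)))

  -- Each 3-cycle of σ has exactly one leader, its point of least index.
  leader : Fin K → ℤ
  leader p = [ toℕ p ≡ orbit-min p ]

  exactly-one-minimum : ∀ {x y z} → x ≢ y → y ≢ z → x ≢ z →
                        [ x ≡ x ⊓ (y ⊓ z) ] + [ y ≡ x ⊓ (y ⊓ z) ] + [ z ≡ x ⊓ (y ⊓ z) ] ≡ + 1
  exactly-one-minimum {x} {y} {z} x≢y y≢z x≢z with ℕ.⊓-sel x (y ⊓ z)
  ... | inj₁ μ≡x rewrite μ≡x | [≡]-refl x | [≡]-≢ (x≢y ∘ sym) | [≡]-≢ (x≢z ∘ sym) = refl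
  ... | inj₂ μ≡y⊓z rewrite μ≡y⊓z with ℕ.⊓-sel y z
  ...   | inj₁ μ≡y rewrite μ≡y | [≡]-≢ x≢y | [≡]-refl y | [≡]-≢ (y≢z ∘ sym) = refl
  ...   | inj₂ μ≡z rewrite μ≡z | [≡]-≢ x≢z | [≡]-≢ y≢z | [≡]-refl z = refl

  orbit-min-σ : ∀ p → orbit-min (σ p) ≡ orbit-min p
  orbit-min-σ p = begin
    toℕ (σ p) ⊓ (toℕ (σ (σ p)) ⊓ toℕ (σ (σ (σ p))))  ≡⟨ cong (λ q → toℕ (σ p) ⊓ (toℕ (σ (σ p)) ⊓ toℕ q)) (σ³≡id p) ⟩
    toℕ (σ p) ⊓ (toℕ (σ (σ p)) ⊓ toℕ p)              ≡⟨ sym (ℕ.⊓-assoc (toℕ (σ p)) _ _) ⟩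
    (toℕ (σ p) ⊓ toℕ (σ (σ p))) ⊓ toℕ p              ≡⟨ ℕ.⊓-comm _ (toℕ p) ⟩
    orbit-min p                                       ∎

  fixed-by-σ² : ∀ p → σ (σ p) ≡ σ p → σ p ≡ p
  fixed-by-σ² p σ²p≡σp = sym (trans (sym (σ³≡id p)) (trans (cong σ σ²p≡σp) σ²p≡σp))

  moved-σ : ∀ p → moved (σ p) ≡ moved p
  moved-σ p = cong (λ b → + 1 when not b) (⌊⌋-⇔ (mk⇔ (fixed-by-σ² p) (cong σ)) (σ (σ p) ≟ σ p) (σ p ≟ p))

  moved-has-one-leader : ∀ p → moved p ≡ moved p * (leader p + leader (σ p) + leader (σ (σ p)))
  moved-has-one-leader p with σ p ≟ p
  ... | yes _   = refl
  ... | no σp≢p = sym (trans (ℤ.*-identityˡ _) (begin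
    leader p + leader (σ p) + leader (σ (σ p))
      ≡⟨ cong₂ (λ μ₁ μ₂ → leader p + [ toℕ (σ p) ≡ μ₁ ] + [ toℕ (σ (σ p)) ≡ μ₂ ])
               (orbit-min-σ p) (trans (orbit-min-σ (σ p)) (orbit-min-σ p)) ⟩
    [ toℕ p ≡ orbit-min p ] + [ toℕ (σ p) ≡ orbit-min p ] + [ toℕ (σ (σ p)) ≡ orbit-min p ]
      ≡⟨ exactly-one-minimum (σp≢p ∘ sym ∘ Fin.toℕ-injective)
                             (σp≢p ∘ fixed-by-σ² p ∘ sym ∘ Fin.toℕ-injective)
                             (λ p≡σ²p → σp≢p (trans (cong σ (Fin.toℕ-injective p≡σ²p)) (σ³≡id p))) ⟩
    + 1 ∎))

  leaders : ℤ
  leaders = sum (λ p → moved p * leader p)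

  ∑-moved-rotated : (τ τ⁻¹ : Fin K → Fin K) → (∀ p → τ (τ⁻¹ p) ≡ p) → (∀ p → τ⁻¹ (τ p) ≡ p) →
                    (∀ p → moved (τ p) ≡ moved p) → sum (λ p → moved p * leader (τ p)) ≡ leaders
  ∑-moved-rotated τ τ⁻¹ ττ⁻¹≡id τ⁻¹τ≡id moved-τ =
    trans (sum-cong-≗ λ p → cong (_* leader (τ p)) (sym (moved-τ p)))
          (∑-reindex τ τ⁻¹ ττ⁻¹≡id τ⁻¹τ≡id (λ p → moved p * leader p))

  ∑-moved : sum moved ≡ + 3 * leaders
  ∑-moved = begin
    sum moved
      ≡⟨ sum-cong-≗ moved-has-one-leader ⟩
    sum (λ p → moved p * (leader p + leader (σ p) + leader (σ (σ p))))
      ≡⟨ sum-cong-≗ (λ p → distrib₃ (moved p) (leader p) (leader (σ p)) (leader (σ (σ p)))) ⟩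
    sum (λ p → moved p * leader p + moved p * leader (σ p) + moved p * leader (σ (σ p)))
      ≡⟨ ∑-distrib-+ (λ p → moved p * leader p + moved p * leader (σ p)) (λ p → moved p * leader (σ (σ p))) ⟩
    sum (λ p → moved p * leader p + moved p * leader (σ p)) + sum (λ p → moved p * leader (σ (σ p)))
      ≡⟨ cong₂ _+_ (∑-distrib-+ (λ p → moved p * leader p) (λ p → moved p * leader (σ p))) refl ⟩
    leaders + sum (λ p → moved p * leader (σ p)) + sum (λ p → moved p * leader (σ (σ p)))
      ≡⟨ cong₂ (λ s₁ s₂ → leaders + s₁ + s₂)
               (∑-moved-rotated σ (σ ∘ σ) σ³≡id σ³≡id moved-σ)
               (∑-moved-rotated (σ ∘ σ) σ σ³≡id σ³≡id (λ p → trans (moved-σ (σ p)) (moved-σ p))) ⟩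
    leaders + leaders + leaders
      ≡⟨ triple leaders ⟩
    + 3 * leaders ∎
    where
    distrib₃ : ∀ a x y z → a * (x + y + z) ≡ a * x + a * y + a * z
    distrib₃ = solve-∀
    triple : ∀ s → s + s + s ≡ + 3 * s
    triple = solve-∀

  fixed-points-mod-3 : ∃ λ s → + K ≡ sum fixed + + 3 * s
  fixed-points-mod-3 = leaders , (begin
    + K                           ≡⟨ sym (∑-const K) ⟩
    sum {K} (λ _ → + 1)           ≡⟨ sum-cong-≗ fixed+moved≡1 ⟨
    sum (λ p → fixed p + moved p) ≡⟨ ∑-distrib-+ fixed moved ⟩
    sum fixed + sum moved         ≡⟨ cong (λ s → sum fixed + s) ∑-moved ⟩
    sum fixed + + 3 * leaders     ∎)
    where
    fixed+moved≡1 : ∀ p → fixed p + moved p ≡ + 1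
    fixed+moved≡1 p with σ p ≟ p
    ... | yes _ = refl
    ... | no _  = refl

  unique-fixed-point⇒3∤K : ∀ p₀ → σ p₀ ≡ p₀ → (∀ p → σ p ≡ p → p ≡ p₀) → ¬ (3 ∣ K)
  unique-fixed-point⇒3∤K p₀ σp₀≡p₀ only-fixed (divides t K≡t*3) with s , K≡fixed+3s ← fixed-points-mod-3 =
    1≢3*u (+ t - s) (begin
      + 1                                ≡⟨ 1≡[1+3x]-3x s ⟩
      (+ 1 + + 3 * s) - + 3 * s          ≡⟨ cong (λ k → (k + + 3 * s) - + 3 * s) ∑-fixed≡1 ⟨
      (sum fixed + + 3 * s) - + 3 * s    ≡⟨ cong (_- + 3 * s) K≡fixed+3s ⟨
      + K - + 3 * s                      ≡⟨ cong (λ k → + k - + 3 * s) K≡t*3 ⟩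
      + (t ℕ.* 3) - + 3 * s              ≡⟨ cong (_- + 3 * s) (ℤ.pos-* t 3) ⟩
      + t * + 3 - + 3 * s                ≡⟨ [t*3]-3x≡3[t-x] (+ t) s ⟩
      + 3 * (+ t - s)                    ∎)
    where
    fixed≡δ : ∀ p → fixed p ≡ + 1 when ⌊ p₀ ≟ p ⌋
    fixed≡δ p = cong (+ 1 when_) (⌊⌋-⇔ (mk⇔ (sym ∘ only-fixed p) (λ p₀≡p → subst (λ q → σ q ≡ q) p₀≡p σp₀≡p₀))
                                       (σ p ≟ p) (p₀ ≟ p))
    ∑-fixed≡1 : sum fixed ≡ + 1
    ∑-fixed≡1 = trans (sum-cong-≗ fixed≡δ) (∑-δ p₀ (λ _ → + 1))
    1≡[1+3x]-3x : ∀ x → + 1 ≡ (+ 1 + + 3 * x) - + 3 * x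
    1≡[1+3x]-3x = solve-∀
    [t*3]-3x≡3[t-x] : ∀ t x → t * + 3 - + 3 * x ≡ + 3 * (t - x)
    [t*3]-3x≡3[t-x] = solve-∀
    1≢3*u : ∀ u → + 1 ≢ + 3 * u
    1≢3*u u 1≡3u with () ← ℕ.m*n≡1⇒m≡1 3 ∣ u ∣ (trans (sym (ℤ.abs-* (+ 3) u)) (cong ∣_∣ (sym 1≡3u)))

module Cauchy₃ {m : ℕ} (G : FinAbGroup m) where
  open import Relation.Nullary using (_×-dec_; ¬?)
  open FinAbGroupProperties G
  open import Algebra.Solver.CommutativeMonoid commutativeMonoid using (solve; _⊜_; _⊕_)
  open ≡-Reasoning

  -- McKay: rotate permutes the triples (a, b, (a b)⁻¹) with product e cyclically;
  -- its fixed points are the (a, a) with a³ = e.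
  rotate : Fin m × Fin m → Fin m × Fin m
  rotate (a , b) = b , (a ∙ b) ⁻¹

  rotate³≡id : ∀ x → rotate (rotate (rotate x)) ≡ x
  rotate³≡id (a , b) = cong₂ _,_ first (trans (cong (λ a′ → (((a ∙ b) ⁻¹) ∙ a′) ⁻¹) first) second)
    where
    first : (b ∙ ((a ∙ b) ⁻¹)) ⁻¹ ≡ a
    first = sym (inverseˡ-unique a (b ∙ ((a ∙ b) ⁻¹)) (trans (sym (assoc a b _)) (inverseʳ (a ∙ b))))
    second : (((a ∙ b) ⁻¹) ∙ a) ⁻¹ ≡ b
    second = sym (inverseˡ-unique b (((a ∙ b) ⁻¹) ∙ a)
      (trans (solve 3 (λ a b c → (b ⊕ (c ⊕ a)) ⊜ (c ⊕ (a ⊕ b))) refl a b ((a ∙ b) ⁻¹)) (inverseˡ (a ∙ b))))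

  rotate-fixed⇒cube≡e : ∀ {a b} → rotate (a , b) ≡ (a , b) → cube a ≡ e
  rotate-fixed⇒cube≡e {a} {b} eq = begin
    a ∙ (a ∙ (a ∙ e))       ≡⟨ cong (λ x → a ∙ (a ∙ x)) (identityʳ a) ⟩
    a ∙ (a ∙ a)             ≡⟨ cong (_∙ (a ∙ a)) (sym [aa]⁻¹≡a) ⟩
    ((a ∙ a) ⁻¹) ∙ (a ∙ a)  ≡⟨ inverseˡ (a ∙ a) ⟩
    e                       ∎
    where
    b≡a : b ≡ a
    b≡a = cong proj₁ eq
    [aa]⁻¹≡a : (a ∙ a) ⁻¹ ≡ a
    [aa]⁻¹≡a = trans (cong (λ x → (a ∙ x) ⁻¹) (sym b≡a)) (trans (cong proj₂ eq) b≡a)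

  encode : Fin m × Fin m → Fin (m ℕ.* m)
  encode (a , b) = Fin.combine a b

  decode : Fin (m ℕ.* m) → Fin m × Fin m
  decode = Fin.remQuot m

  σ : Fin (m ℕ.* m) → Fin (m ℕ.* m)
  σ = encode ∘ rotate ∘ decode

  σ³≡id : ∀ p → σ (σ (σ p)) ≡ p
  σ³≡id p = begin
    encode (rotate (decode (encode (rotate (decode (encode (rotate (decode p))))))))
      ≡⟨ cong (λ x → encode (rotate (decode (encode (rotate x))))) (Fin.remQuot-combine _ _) ⟩
    encode (rotate (decode (encode (rotate (rotate (decode p))))))
      ≡⟨ cong (encode ∘ rotate) (Fin.remQuot-combine _ _) ⟩
    encode (rotate (rotate (rotate (decode p))))
      ≡⟨ cong encode (rotate³≡id (decode p)) ⟩
    encode (decode p)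
      ≡⟨ Fin.combine-remQuot {m} m p ⟩
    p ∎

  p₀ : Fin (m ℕ.* m)
  p₀ = encode (e , e)

  σp₀≡p₀ : σ p₀ ≡ p₀
  σp₀≡p₀ = trans (cong (encode ∘ rotate) (Fin.remQuot-combine e e))
                 (cong (λ x → encode (e , x)) (trans (cong _⁻¹ (identityˡ e)) ε⁻¹≈ε))

  σ-fixed⇒rotate-fixed : ∀ p → σ p ≡ p → rotate (decode p) ≡ decode p
  σ-fixed⇒rotate-fixed p σp≡p = trans (sym (Fin.remQuot-combine _ _)) (cong decode σp≡p)

  cauchy₃ : 3 ∣ m → ∃ λ a → a ≢ e × cube a ≡ e
  cauchy₃ 3∣m with Fin.any? (λ p → σ p ≟ p ×-dec ¬? (p ≟ p₀))
  ... | yes (p , σp≡p , p≢p₀) = a , a≢e , rotate-fixed⇒cube≡e (σ-fixed⇒rotate-fixed p σp≡p)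
    where
    a = proj₁ (decode p)
    a≢e : a ≢ e
    a≢e a≡e = p≢p₀ (begin
      p                 ≡⟨ Fin.combine-remQuot {m} m p ⟨
      encode (decode p) ≡⟨ cong encode (cong₂ _,_ a≡e (trans (cong proj₁ (σ-fixed⇒rotate-fixed p σp≡p)) a≡e)) ⟩
      p₀                ∎)
  ... | no only-p₀ = ⊥-elim (unique-fixed-point⇒3∤K p₀ σp₀≡p₀ only-fixed (∣m⇒∣m*n m 3∣m))
    where
    open FixedPointsMod3 σ σ³≡id using (unique-fixed-point⇒3∤K)
    only-fixed : ∀ p → σ p ≡ p → p ≡ p₀
    only-fixed p σp≡p = decidable-stable (p ≟ p₀) (λ p≢p₀ → only-p₀ (p , σp≡p , p≢p₀))

injective⇒surjective : ∀ {n} (f : Fin n → Fin n) → (∀ {x y} → f x ≡ f y → x ≡ y) → ∀ y → ∃ λ x → f x ≡ y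
injective⇒surjective {suc n} f f-injective y with Fin.any? (λ x → f x ≟ y)
... | yes hit = hit
... | no miss = ⊥-elim (ℕ.1+n≰n (Fin.injective⇒≤ punchOut∘f-injective))
  where
  y≢f : ∀ x → y ≢ f x
  y≢f x y≡fx = miss (x , sym y≡fx)
  punchOut∘f-injective : ∀ {x x′} → Fin.punchOut (y≢f x) ≡ Fin.punchOut (y≢f x′) → x ≡ x′
  punchOut∘f-injective eq = f-injective (Fin.punchOut-injective (y≢f _) (y≢f _) eq)

module NonCube {m : ℕ} (G : FinAbGroup m) where
  open import Relation.Nullary using (¬?)
  open FinAbGroupProperties G
  open Cauchy₃ G using (cauchy₃)

  non-cube : 3 ∣ m → ∃ λ w → ∀ h → cube h ≢ w
  non-cube 3∣m with Fin.any? (λ w → ¬? (Fin.any? (λ h → cube h ≟ w)))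
  ... | yes (w , no-root) = w , λ h h³≡w → no-root (h , h³≡w)
  ... | no all-cubes =
    let a , a≢e , a³≡e = cauchy₃ 3∣m in ⊥-elim (a≢e (cube-injective (trans a³≡e (sym cube-e))))
    where
    cube-root : ∀ w → ∃ λ h → cube h ≡ w
    cube-root w = decidable-stable (Fin.any? (λ h → cube h ≟ w)) (λ no-root → all-cubes (w , no-root))
    root : Fin m → Fin m
    root w = proj₁ (cube-root w)
    root-injective : ∀ {x y} → root x ≡ root y → x ≡ y
    root-injective {x} {y} eq = trans (sym (proj₂ (cube-root x))) (trans (cong cube eq) (proj₂ (cube-root y)))
    root∘cube≡id : ∀ x → root (cube x) ≡ x
    root∘cube≡id x with w , root-w≡x ← injective⇒surjective root root-injective x =
      trans (cong (root ∘ cube) (sym root-w≡x)) (trans (cong root (proj₂ (cube-root w))) root-w≡x)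
    cube-injective : ∀ {x y} → cube x ≡ cube y → x ≡ y
    cube-injective {x} {y} eq = trans (sym (root∘cube≡id x)) (trans (cong root eq) (root∘cube≡id y))

module CubeSubgroups {m : ℕ} (G : FinAbGroup m) where
  open import Data.Nat.DivMod using (_mod_; _divMod_; DivMod)
  open import Data.Bool.Properties using (T?)
  open import Relation.Nullary.Decidable using (toWitness; fromWitness)
  open FinAbGroupProperties G
  open import Algebra.Solver.CommutativeMonoid commutativeMonoid using (solve; _⊜_; _⊕_)
  open CyclicGroup₃
  open ≡-Reasoning

  _∈ᵀ_ : Fin m → Subset m → Set
  x ∈ᵀ M = T (M x)

  record CubeSubgroup (M : Subset m) : Set where
    field
      ∙-closed : ∀ {x y} → x ∈ᵀ M → y ∈ᵀ M → (x ∙ y) ∈ᵀ M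
      cube∈    : ∀ x → cube x ∈ᵀ M

    e∈ : e ∈ᵀ M
    e∈ = subst (_∈ᵀ M) cube-e (cube∈ e)

    cancel-cube : ∀ {x} h → (x ∙ cube h) ∈ᵀ M → x ∈ᵀ M
    cancel-cube {x} h x∙h³∈M = subst (_∈ᵀ M) x∙h³∙[h⁻¹]³≡x (∙-closed x∙h³∈M (cube∈ (h ⁻¹)))
      where
      x∙h³∙[h⁻¹]³≡x : (x ∙ cube h) ∙ cube (h ⁻¹) ≡ x
      x∙h³∙[h⁻¹]³≡x = begin
        (x ∙ cube h) ∙ cube (h ⁻¹)  ≡⟨ assoc x _ _ ⟩
        x ∙ (cube h ∙ cube (h ⁻¹))  ≡⟨ cong (x ∙_) (sym (cube-∙ h (h ⁻¹))) ⟩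
        x ∙ cube (h ∙ (h ⁻¹))       ≡⟨ cong (λ y → x ∙ cube y) (inverseʳ h) ⟩
        x ∙ cube e                  ≡⟨ cong (x ∙_) cube-e ⟩
        x ∙ e                       ≡⟨ identityʳ x ⟩
        x                           ∎

  -- x lies in the coset M u⁻ⁱ.
  InCoset : Subset m → Fin m → Fin 3 → Fin m → Set
  InCoset M u i x = (x ∙ u ^ toℕ i) ∈ᵀ M

  module _ {M : Subset m} (M-sub : CubeSubgroup M) where
    open CubeSubgroup M-sub

    reduce-exponent : ∀ {x} u n → (x ∙ u ^ n) ∈ᵀ M → (x ∙ u ^ toℕ (n mod 3)) ∈ᵀ M
    reduce-exponent {x} u n x∙uⁿ∈M = cancel-cube (u ^ q) (subst (_∈ᵀ M) x∙uⁿ≡x∙uʳ∙[u^q]³ x∙uⁿ∈M)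
      where
      open DivMod (n divMod 3) renaming (quotient to q; remainder to r; property to n≡r+q*3)
      x∙uⁿ≡x∙uʳ∙[u^q]³ : x ∙ u ^ n ≡ (x ∙ u ^ toℕ r) ∙ cube (u ^ q)
      x∙uⁿ≡x∙uʳ∙[u^q]³ = begin
        x ∙ u ^ n                            ≡⟨ cong (λ k → x ∙ u ^ k) n≡r+q*3 ⟩
        x ∙ u ^ (toℕ r ℕ.+ q ℕ.* 3)          ≡⟨ cong (x ∙_) (^-+ u (toℕ r) (q ℕ.* 3)) ⟩
        x ∙ (u ^ toℕ r ∙ u ^ (q ℕ.* 3))      ≡⟨ sym (assoc x _ _) ⟩
        (x ∙ u ^ toℕ r) ∙ u ^ (q ℕ.* 3)      ≡⟨ cong (λ k → (x ∙ u ^ toℕ r) ∙ u ^ k) (ℕ.*-comm q 3) ⟩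
        (x ∙ u ^ toℕ r) ∙ u ^ (3 ℕ.* q)      ≡⟨ cong ((x ∙ u ^ toℕ r) ∙_) (sym (^-* u q 3)) ⟩
        (x ∙ u ^ toℕ r) ∙ cube (u ^ q)       ∎

    InCoset-∙ : ∀ {u i j x y} → InCoset M u i x → InCoset M u j y → InCoset M u (i +₃ j) (x ∙ y)
    InCoset-∙ {u} {i} {j} {x} {y} x∈ y∈ =
      reduce-exponent u (toℕ i ℕ.+ toℕ j) (subst (_∈ᵀ M) rearrange (∙-closed x∈ y∈))
      where
      rearrange : (x ∙ u ^ toℕ i) ∙ (y ∙ u ^ toℕ j) ≡ (x ∙ y) ∙ u ^ (toℕ i ℕ.+ toℕ j)
      rearrange = trans (solve 4 (λ x y p q → ((x ⊕ p) ⊕ (y ⊕ q)) ⊜ ((x ⊕ y) ⊕ (p ⊕ q))) refl x y (u ^ toℕ i) (u ^ toℕ j))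
                        (cong ((x ∙ y) ∙_) (sym (^-+ u (toℕ i) (toℕ j))))

    InCoset-∙-member : ∀ {u i y z} → z ∈ᵀ M → InCoset M u i y → InCoset M u i (y ∙ z)
    InCoset-∙-member {u} {i} {y} {z} z∈ y∈ =
      subst (_∈ᵀ M) (solve 3 (λ y z p → ((y ⊕ p) ⊕ z) ⊜ ((y ⊕ z) ⊕ p)) refl y z (u ^ toℕ i)) (∙-closed y∈ z∈)

  in-extension? : ∀ M u x → Dec (∃ λ i → InCoset M u i x)
  in-extension? M u x = Fin.any? (λ i → T? (M (x ∙ u ^ toℕ i)))

  extend : Subset m → Fin m → Subset m
  extend M u x = ⌊ in-extension? M u x ⌋

  extend-intro : ∀ M u {x} i → InCoset M u i x → x ∈ᵀ extend M u
  extend-intro M u {x} i x∈ = fromWitness {a? = in-extension? M u x} (i , x∈)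

  extend-elim : ∀ M u {x} → x ∈ᵀ extend M u → ∃ λ i → InCoset M u i x
  extend-elim M u {x} = toWitness {a? = in-extension? M u x}

  extend-⊇ : ∀ M u {x} → x ∈ᵀ M → x ∈ᵀ extend M u
  extend-⊇ M u {x} x∈M = extend-intro M u {x} 0F (subst (_∈ᵀ M) (sym (identityʳ _)) x∈M)

  extend-∋ : ∀ {M} u → CubeSubgroup M → u ∈ᵀ extend M u
  extend-∋ {M} u M-sub = extend-intro M u {u} 2F (CubeSubgroup.cube∈ M-sub u)

  extend-mono : ∀ {M M′} → (∀ {x} → x ∈ᵀ M → x ∈ᵀ M′) → ∀ u {x} → x ∈ᵀ extend M u → x ∈ᵀ extend M′ u
  extend-mono {M} {M′} M⊆M′ u {x} x∈ with i , x∈M ← extend-elim M u {x} x∈ = extend-intro M′ u i (M⊆M′ x∈M)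

  extend-CubeSubgroup : ∀ {M} u → CubeSubgroup M → CubeSubgroup (extend M u)
  extend-CubeSubgroup {M} u M-sub = record
    { ∙-closed = λ {x} {y} x∈ y∈ →
        let i , x∈′ = extend-elim M u {x} x∈
            j , y∈′ = extend-elim M u {y} y∈
        in extend-intro M u (i +₃ j) (InCoset-∙ M-sub {u} {i} {j} {x} {y} x∈′ y∈′)
    ; cube∈    = λ x → extend-⊇ M u {cube x} (CubeSubgroup.cube∈ M-sub x)
    }

module Character₃ {m : ℕ} (G : FinAbGroup m) (w : Fin m) (w-non-cube : ∀ h → FinAbGroupProperties.cube G h ≢ w) where
  open import Relation.Nullary.Decidable using (toWitness; fromWitness)
  open import Data.List using (List; []; _∷_; allFin)
  open import Data.List.Membership.Propositional using (_∈_)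
  open import Data.List.Membership.Propositional.Properties using (∈-allFin)
  open import Data.List.Relation.Unary.Any using (here; there)
  open FinAbGroupProperties G
  open CubeSubgroups G
  open import Algebra.Solver.CommutativeMonoid commutativeMonoid using (solve; _⊜_; _⊕_; id)
  open CyclicGroup₃
  open ≡-Reasoning

  Avoids-w : Subset m → Set
  Avoids-w M = CubeSubgroup M × ¬ (w ∈ᵀ M)

  step : Subset m → Fin m → Subset m
  step M g = if extend M g w then M else extend M g

  step-avoids : ∀ {M} g → Avoids-w M → Avoids-w (step M g)
  step-avoids {M} g (M-sub , w∉M) with extend M g w in eq
  ... | true  = M-sub , w∉M
  ... | false = extend-CubeSubgroup g M-sub , λ w∈ → subst T eq w∈

  step-⊇ : ∀ {M} g {x} → x ∈ᵀ M → x ∈ᵀ step M g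
  step-⊇ {M} g x∈M with extend M g w
  ... | true  = x∈M
  ... | false = extend-⊇ M g x∈M

  step-decides : ∀ {M} g → CubeSubgroup M → g ∈ᵀ step M g ⊎ w ∈ᵀ extend (step M g) g
  step-decides {M} g M-sub with extend M g w in eq
  ... | true  = inj₂ (subst T (sym eq) _)
  ... | false = inj₁ (extend-∋ g M-sub)

  grow : List (Fin m) → Subset m → Subset m
  grow []       M = M
  grow (g ∷ gs) M = grow gs (step M g)

  grow-avoids : ∀ gs {M} → Avoids-w M → Avoids-w (grow gs M)
  grow-avoids []       M-av = M-av
  grow-avoids (g ∷ gs) M-av = grow-avoids gs (step-avoids g M-av)

  grow-⊇ : ∀ gs {M x} → x ∈ᵀ M → x ∈ᵀ grow gs M
  grow-⊇ []       x∈M = x∈M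
  grow-⊇ (g ∷ gs) {M} {x} x∈M = grow-⊇ gs (step-⊇ {M} g {x} x∈M)

  grow-decides : ∀ gs {M g} → Avoids-w M → g ∈ gs → g ∈ᵀ grow gs M ⊎ w ∈ᵀ extend (grow gs M) g
  grow-decides (g ∷ gs) {M} M-av (here refl) with step-decides g (proj₁ M-av)
  ... | inj₁ g∈  = inj₁ (grow-⊇ gs g∈)
  ... | inj₂ w∈  = inj₂ (extend-mono (λ {x} → grow-⊇ gs {step M g} {x}) g {w} w∈)
  grow-decides (g′ ∷ gs) M-av (there g∈gs) = grow-decides gs (step-avoids g′ M-av) g∈gs

  cubes : Subset m
  cubes x = ⌊ Fin.any? (λ h → cube h ≟ x) ⌋

  cubes-avoid-w : Avoids-w cubes
  cubes-avoid-w = record { ∙-closed = ∙-closed ; cube∈ = cube∈ } , w∉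
    where
    cube-root : ∀ {x} → x ∈ᵀ cubes → ∃ λ h → cube h ≡ x
    cube-root {x} = toWitness {a? = Fin.any? (λ h → cube h ≟ x)}
    cube∈ : ∀ h → cube h ∈ᵀ cubes
    cube∈ h = fromWitness {a? = Fin.any? (λ h′ → cube h′ ≟ cube h)} (h , refl)
    ∙-closed : ∀ {x y} → x ∈ᵀ cubes → y ∈ᵀ cubes → (x ∙ y) ∈ᵀ cubes
    ∙-closed {x} {y} x∈ y∈ with a , a³≡x ← cube-root x∈ | b , b³≡y ← cube-root y∈ =
      subst (_∈ᵀ cubes) (trans (cube-∙ a b) (cong₂ _∙_ a³≡x b³≡y)) (cube∈ (a ∙ b))
    w∉ : ¬ (w ∈ᵀ cubes)
    w∉ w∈ = w-non-cube _ (proj₂ (cube-root w∈))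

  -- A maximal subgroup containing all cubes but not w; its cosets are M★, M★ w, M★ w².
  M★ : Subset m
  M★ = grow (allFin m) cubes

  M★-sub : CubeSubgroup M★
  M★-sub = proj₁ (grow-avoids (allFin m) cubes-avoid-w)

  w∉M★ : ¬ (w ∈ᵀ M★)
  w∉M★ = proj₂ (grow-avoids (allFin m) cubes-avoid-w)

  open CubeSubgroup M★-sub

  classify : ∀ x → ∃ λ i → InCoset M★ w i x
  classify x with grow-decides (allFin m) cubes-avoid-w (∈-allFin x)
  ... | inj₁ x∈M★ = 0F , subst (_∈ᵀ M★) (sym (identityʳ x)) x∈M★
  ... | inj₂ w∈ with extend-elim M★ x {w} w∈
  ...   | 0F , w∙e∈M★  = ⊥-elim (w∉M★ (subst (_∈ᵀ M★) (identityʳ w) w∙e∈M★))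
  ...   | 1F , w∙x∈M★  = 1F , subst (_∈ᵀ M★) w∙x≡x∙w w∙x∈M★
    where
    w∙x≡x∙w : w ∙ (x ∙ e) ≡ x ∙ (w ∙ e)
    w∙x≡x∙w = solve 2 (λ w x → (w ⊕ (x ⊕ id)) ⊜ (x ⊕ (w ⊕ id))) refl w x
  ...   | 2F , w∙x²∈M★ = 2F , cancel-cube x (subst (_∈ᵀ M★) square (∙-closed w∙x²∈M★ w∙x²∈M★))
    where
    square : (w ∙ (x ∙ (x ∙ e))) ∙ (w ∙ (x ∙ (x ∙ e))) ≡ (x ∙ (w ∙ (w ∙ e))) ∙ (x ∙ (x ∙ (x ∙ e)))
    square = solve 2 (λ w x → ((w ⊕ (x ⊕ (x ⊕ id))) ⊕ (w ⊕ (x ⊕ (x ⊕ id))))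
                               ⊜ ((x ⊕ (w ⊕ (w ⊕ id))) ⊕ (x ⊕ (x ⊕ (x ⊕ id))))) refl w x

  x⁻¹≡x²∙[x⁻¹]³ : ∀ x → x ⁻¹ ≡ (x ∙ x) ∙ cube (x ⁻¹)
  x⁻¹≡x²∙[x⁻¹]³ x = sym (begin
    (x ∙ x) ∙ (y ∙ (y ∙ (y ∙ e)))
      ≡⟨ solve 2 (λ x y → ((x ⊕ x) ⊕ (y ⊕ (y ⊕ (y ⊕ id)))) ⊜ (((x ⊕ y) ⊕ (x ⊕ y)) ⊕ y)) refl x y ⟩
    ((x ∙ y) ∙ (x ∙ y)) ∙ y        ≡⟨ cong (λ z → (z ∙ z) ∙ y) (inverseʳ x) ⟩
    (e ∙ e) ∙ y                    ≡⟨ trans (cong (_∙ y) (identityˡ e)) (identityˡ y) ⟩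
    y                              ∎)
    where
    y = x ⁻¹

  coset-of-e : ∀ {k} → InCoset M★ w k e → k ≡ 0F
  coset-of-e {0F} _     = refl
  coset-of-e {1F} e∙w∈ = ⊥-elim (w∉M★ (subst (_∈ᵀ M★) (trans (identityˡ _) (identityʳ w)) e∙w∈))
  coset-of-e {2F} e∙w²∈
    with () ← coset-of-e {1F} (subst (InCoset M★ w 1F) (identityˡ e) (InCoset-∙ M★-sub {w} {2F} {2F} {e} {e} e∙w²∈ e∙w²∈))

  coset-unique : ∀ {i j x} → InCoset M★ w i x → InCoset M★ w j x → i ≡ j
  coset-unique {i} {j} {x} x∈i x∈j = +₃-cancel i j (coset-of-e x∙x⁻¹∈)
    where
    x⁻¹∈ : InCoset M★ w (j +₃ j) (x ⁻¹)
    x⁻¹∈ = subst (InCoset M★ w (j +₃ j)) (sym (x⁻¹≡x²∙[x⁻¹]³ x))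
             (InCoset-∙-member M★-sub {w} {j +₃ j} {x ∙ x} (cube∈ (x ⁻¹)) (InCoset-∙ M★-sub {w} {j} {j} {x} {x} x∈j x∈j))
    x∙x⁻¹∈ : InCoset M★ w (i +₃ (j +₃ j)) e
    x∙x⁻¹∈ = subst (InCoset M★ w (i +₃ (j +₃ j))) (inverseʳ x) (InCoset-∙ M★-sub {w} {i} {j +₃ j} {x} {x ⁻¹} x∈i x⁻¹∈)

  χ : Fin m → Fin 3
  χ x = proj₁ (classify x)

  χ-hom : IsHomomorphism G C₃ χ
  χ-hom x y = coset-unique (proj₂ (classify (x ∙ y)))
                           (InCoset-∙ M★-sub {w} {χ x} {χ y} {x} {y} (proj₂ (classify x)) (proj₂ (classify y)))

  χ-onto : ∀ i → ∃ λ u → χ u ≡ i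
  χ-onto 0F = e     , coset-unique (proj₂ (classify e)) (subst (_∈ᵀ M★) (sym (identityˡ e)) e∈)
  χ-onto 1F = w ∙ w , coset-unique (proj₂ (classify (w ∙ w)))
                                   (InCoset-∙ M★-sub {w} {2F} {2F} {w} {w} (cube∈ w) (cube∈ w))
  χ-onto 2F = w     , coset-unique (proj₂ (classify w)) (cube∈ w)

module ProjectionToC₃ {m : ℕ} (H : FinAbGroup m) (3∣m : 3 ∣ m) where
  open import Data.Integer using (_+_; _-_)
  open FinAbGroup H
  open GroupRing H
  open CyclicGroup₃
  open NonCube H using (non-cube)
  open Character₃ H (proj₁ (non-cube 3∣m)) (proj₂ (non-cube 3∣m)) using (χ; χ-hom; χ-onto)
  open Pushforward H C₃ χ χ-hom
  module ℤ[C₃] = GroupRing C₃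
  open Sums using (_when_)
  open ≡-Reasoning

  ⟦⟧-inverse-closed : ∀ T → InverseClosed T → ∀ g → ⟦ T ⟧ (g ⁻¹) ≡ ⟦ T ⟧ g
  ⟦⟧-inverse-closed T T⁻¹≡T g = cong (+ 1 when_) (T⁻¹≡T g)

  relations⇒N≡2 : ∀ (T₀ T₁ : Subset m) N → InverseClosed T₀ → InverseClosed T₁ →
    (∀ g → (⟦ T₀ ⟧ ⊛ ⟦ T₁ ⟧) g ≡ (HR ⊖ eR) g) →
    (∀ g → ((⟦ T₀ ⟧ ⊛ ⟦ T₀ ⟧) ⊕ (⟦ T₁ ⟧ ⊛ ⟦ T₁ ⟧)) g ≡ (((((+ 2) · HR) ⊖ sq ⟦ T₀ ⟧) ⊖ sq ⟦ T₁ ⟧) ⊕ (N · eR)) g) →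
    N ≡ + 2
  relations⇒N≡2 T₀ T₁ N T₀⁻¹≡T₀ T₁⁻¹≡T₁ T₀T₁≡H-e squares≡ =
    C₃Relations.relations-in-ℤ[C₃]⇒N≡2 (push A) (push B) (push HR) N
      (push-inverse-closed A (⟦⟧-inverse-closed T₀ T₀⁻¹≡T₀) 1F)
      (push-inverse-closed B (⟦⟧-inverse-closed T₁ T₁⁻¹≡T₁) 1F)
      (push-HR-constant χ-onto 1F 0F)
      pushed-product
      pushed-squares
    where
    A = ⟦ T₀ ⟧
    B = ⟦ T₁ ⟧
    pushed-product : ∀ i → (push A ℤ[C₃].⊛ push B) i ≡ (push HR ℤ[C₃].⊖ ℤ[C₃].eR) i
    pushed-product i = begin
      (push A ℤ[C₃].⊛ push B) i  ≡⟨ push-⊛ A B i ⟨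
      push (A ⊛ B) i             ≡⟨ push-cong T₀T₁≡H-e i ⟩
      push (HR ⊖ eR) i           ≡⟨ push-⊖ HR eR i ⟩
      push HR i - push eR i      ≡⟨ cong (push HR i -_) (push-eR i) ⟩
      (push HR ℤ[C₃].⊖ ℤ[C₃].eR) i ∎
    pushed-squares : ∀ i → ((push A ℤ[C₃].⊛ push A) ℤ[C₃].⊕ (push B ℤ[C₃].⊛ push B)) i
                         ≡ (((((+ 2) ℤ[C₃].· push HR) ℤ[C₃].⊖ ℤ[C₃].sq (push A)) ℤ[C₃].⊖ ℤ[C₃].sq (push B))
                             ℤ[C₃].⊕ (N ℤ[C₃].· ℤ[C₃].eR)) i
    pushed-squares i = begin
      (push A ℤ[C₃].⊛ push A) i + (push B ℤ[C₃].⊛ push B) i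
        ≡⟨ cong₂ _+_ (push-⊛ A A i) (push-⊛ B B i) ⟨
      push (A ⊛ A) i + push (B ⊛ B) i
        ≡⟨ push-⊕ (A ⊛ A) (B ⊛ B) i ⟨
      push ((A ⊛ A) ⊕ (B ⊛ B)) i
        ≡⟨ push-cong squares≡ i ⟩
      push (((((+ 2) · HR) ⊖ sq A) ⊖ sq B) ⊕ (N · eR)) i
        ≡⟨ push-⊕ _ (N · eR) i ⟩
      push ((((+ 2) · HR) ⊖ sq A) ⊖ sq B) i + push (N · eR) i
        ≡⟨ cong₂ _+_ (push-⊖ _ (sq B) i) (push-· N eR i) ⟩
      (push (((+ 2) · HR) ⊖ sq A) i - push (sq B) i) + N ℤ.* push eR i
        ≡⟨ cong₂ (λ a b → (a - push (sq B) i) + b) (push-⊖ ((+ 2) · HR) (sq A) i) (cong (N ℤ.*_) (push-eR i)) ⟩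
      ((push ((+ 2) · HR) i - push (sq A) i) - push (sq B) i) + N ℤ.* ℤ[C₃].eR i
        ≡⟨ cong (λ a → ((a - push (sq A) i) - push (sq B) i) + N ℤ.* ℤ[C₃].eR i) (push-· (+ 2) HR i) ⟩
      ((+ 2 ℤ.* push HR i - push (sq A) i) - push (sq B) i) + N ℤ.* ℤ[C₃].eR i
        ≡⟨ cong₂ (λ a b → ((+ 2 ℤ.* push HR i - a) - b) + N ℤ.* ℤ[C₃].eR i) (push-sq A i) (push-sq B i) ⟩
      ((((+ 2) ℤ[C₃].· push HR) ℤ[C₃].⊖ ℤ[C₃].sq (push A)) ℤ[C₃].⊖ ℤ[C₃].sq (push B)) i + N ℤ.* ℤ[C₃].eR i ∎

open import Data.Nat using (ℕ; _+_; _*_; _≥_; _%_)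
open import Data.Integer using (+_)
open import Data.Product using (_×_; Σ)
open import Relation.Nullary using (¬_)
open import Relation.Binary.PropositionalEquality using (_≡_)

3∣n²+n+1 : ∀ n → n % 6 ≡ 1 → 3 ∣ n * n + n + 1
3∣n²+n+1 n n%6≡1 = divides (12 * q * q + 6 * q + 1) (begin
  n * n + n + 1                                   ≡⟨ cong (λ k → k * k + k + 1) n≡1+6q ⟩
  (1 + q * 6) * (1 + q * 6) + (1 + q * 6) + 1     ≡⟨ expand q ⟩
  (12 * q * q + 6 * q + 1) * 3                    ∎)
  where
  open ≡-Reasoning
  open import Data.Nat.Tactic.RingSolver using (solve-∀)
  open import Data.Nat.DivMod using (_/_; m≡m%n+[m/n]*n)
  q = n / 6
  n≡1+6q : n ≡ 1 + q * 6
  n≡1+6q = trans (m≡m%n+[m/n]*n n 6) (cong (_+ q * 6) n%6≡1)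
  expand : ∀ q → (1 + q * 6) * (1 + q * 6) + (1 + q * 6) + 1 ≡ (12 * q * q + 6 * q + 1) * 3
  expand = solve-∀

proposition7p4 : (n : ℕ) → n ≥ 125 → n % 5 ≡ 2 → n % 6 ≡ 1 →
    (H : FinAbGroup (n * n + n + 1)) →
    let open FinAbGroup H in
    let open GroupRing H in
    ¬ (Σ (Subset (n * n + n + 1)) λ T₀ → Σ (Subset (n * n + n + 1)) λ T₁ →
        InverseClosed T₀ × InverseClosed T₁ × e ∈ T₀ ×
        (∀ g → (⟦ T₀ ⟧ ⊛ ⟦ T₁ ⟧) g ≡ (HR ⊖ eR) g) ×
        (∀ g → ((⟦ T₀ ⟧ ⊛ ⟦ T₀ ⟧) ⊕ (⟦ T₁ ⟧ ⊛ ⟦ T₁ ⟧)) g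
          ≡ (((((+ 2) · HR) ⊖ sq ⟦ T₀ ⟧) ⊖ sq ⟦ T₁ ⟧) ⊕ ((+ (2 * n)) · eR)) g))
proposition7p4 n n≥125 _ n%6≡1 H (T₀ , T₁ , T₀⁻¹≡T₀ , T₁⁻¹≡T₁ , _ , T₀T₁≡H-e , squares≡) =
  ℕ.<⇒≢ 1<n (sym n≡1)
  where
  open ProjectionToC₃ H (3∣n²+n+1 n n%6≡1)
  1<n : 1 ℕ.< n
  1<n = ℕ.<-≤-trans (ℕ.s≤s (ℕ.s≤s ℕ.z≤n)) n≥125
  2n≡2 : + (2 * n) ≡ + 2
  2n≡2 = relations⇒N≡2 T₀ T₁ (+ (2 * n)) T₀⁻¹≡T₀ T₁⁻¹≡T₁ T₀T₁≡H-e squares≡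
  n≡1 : n ≡ 1
  n≡1 = ℕ.*-cancelˡ-≡ n 1 2 (ℤ.+-injective 2n≡2)
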